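{- For every positive integer $k$, the exponential generating function of the numbers $p^k_n$ is $$\sum_{n=0}^{\infty}\frac{p^k_n\, m^n}{n!}=\frac{e^{km}}{2-e^m}$$ (as formal power series in $m$).
   Context: For $n\ge 0$ let $X_n=\{1,\dots,n\}$. A preferential arrangement of a finite set $S$ is an ordered set partition of $S$, i.e. a sequence of nonempty pairwise disjoint subsets (blocks) whose union is $S$; the empty set has exactly one (empty) preferential arrangement. Let $a(w)$ denote the number of preferential arrangements of a $w$-element set (so $a(0)=1$, $a(1)=1$, $a(2)=3$, $a(3)=13,\dots$). A barred preferential arrangement of $X_n$ with $k$ bars consists of a sequence of $k+1$ sections $(S_1,\dots,S_{k+1})$ of pairwise disjoint, possibly empty subsets of $X_n$ with union $X_n$, each section $S_i$ being equipped with a preferential arrangement of $S_i$. A restricted section is one whose preferential arrangement has at most one block (so there is exactly one choice for it); a free section may carry any preferential arrangement of its elements. For $k\ge 0$, $p^k_n$ denotes the number of barred preferential arrangements of $X_n$ with $k$ bars in which one fixed section is free and the other $k$ sections are restricted; equivalently $$p^k_n=\sum_{w_1+\cdots+w_{k+1}=n}\frac{n!}{w_1!\cdots w_{k+1}!}\,a(w_{j_0})$$ for a fixed index $j_0\in\{1,\dots,k+1\}$, the sum over nonnegative integer solutions. In particular $p^0_n=a(n)$. -}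

module Defs where

open import Data.Nat using (ℕ; zero; suc; _+_; _*_; _∸_; _^_; _!; NonZero)
open import Data.Nat.Properties using (_!≢0; m*n≢0)
import Data.Nat as ℕ
open import Data.Fin using (Fin; _≟_)
open import Data.Fin.Base using () renaming (zero to fz; suc to fs)
open import Data.Vec using (Vec; []; _∷_; lookup; foldr)
import Data.Vec as Vec
open import Data.List.Base using (List; []; _∷_; map; concatMap; upTo; allFin; length; filter; all)
open import Data.Nat.ListAction using (sum)
open import Data.Bool using (Bool; true; false)
open import Relation.Nullary.Decidable using (⌊_⌋)
open import Data.Integer using (+_; -[1+_])
open import Data.Rational using (ℚ; _/_; 0ℚ; 1ℚ) renaming (_+_ to _+ℚ_; _*_ to _*ℚ_; _-_ to _-ℚ_)

allMaps : (b n : ℕ) → List (Vec (Fin b) n)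
allMaps b zero    = [] ∷ []
allMaps b (suc n) = concatMap (λ i → map (i ∷_) (allMaps b n)) (allFin b)

isSurjective : {b n : ℕ} → Vec (Fin b) n → Bool
isSurjective {b} f = all (λ j → Vec.foldr _ (λ i r → Data.Bool._∨_ ⌊ i ≟ j ⌋ r) false f) (allFin b)

-- An ordered set partition of X_n into b (nonempty) blocks B_0,…,B_{b-1}
-- is the same as a surjection X_n → Fin b (element ↦ index of its block).
-- a(n) = number of preferential arrangements of an n-element set
--      = Σ_{b=0}^{n} #(surjections X_n → Fin b).
a : ℕ → ℕ
a n = sum (map (λ b → length (filter (λ f → isSurjective f Data.Bool.≟ true) (allMaps b n))) (upTo (suc n)))

compositions : (r n : ℕ) → List (Vec ℕ r)
compositions zero zero    = [] ∷ []
compositions zero (suc n) = []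
compositions (suc r) n =
  concatMap (λ w → map (w ∷_) (compositions r (n ∸ w))) (upTo (suc n))

prodFact : {r : ℕ} → Vec ℕ r → ℕ
prodFact []       = 1
prodFact (w ∷ ws) = w ! * prodFact ws

prodFact≢0 : {r : ℕ} (ws : Vec ℕ r) → NonZero (prodFact ws)
prodFact≢0 []       = _
prodFact≢0 (w ∷ ws) = m*n≢0 (w !) (prodFact ws) {{w !≢0}} {{prodFact≢0 ws}}

multinomial : {r : ℕ} → ℕ → Vec ℕ r → ℕ
multinomial n ws = ℕ._/_ (n !) (prodFact ws) {{prodFact≢0 ws}}

-- p^k_n with free section j₀ ∈ {1,…,k+1} (as Fin (k+1))
p : (k : ℕ) → Fin (suc k) → ℕ → ℕ
p k j₀ n = sum (map (λ ws → multinomial n ws * a (lookup ws j₀)) (compositions (suc k) n))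

-- Formal power series over ℚ, as coefficient sequences (coefficient of m^n)

Series : Set
Series = ℕ → ℚ

sumℚ : List ℚ → ℚ
sumℚ []       = 0ℚ
sumℚ (x ∷ xs) = x +ℚ sumℚ xs

_⊛_ : Series → Series → Series
(f ⊛ g) n = sumℚ (map (λ i → f i *ℚ g (n ∸ i)) (upTo (suc n)))

_⊖_ : Series → Series → Series
(f ⊖ g) n = f n -ℚ g n

constS : ℚ → Series
constS c zero    = c
constS c (suc n) = 0ℚ

egf : (ℕ → ℕ) → Series
egf u n = ((+ u n) / (n !)) {{n !≢0}}

expS : ℕ → Series
expS c n = ((+ (c ^ n)) / (n !)) {{n !≢0}}

-- Write u ⋆ v for the binomial convolution of sequences, so that the exponential generating
-- function of u ⋆ v is the product of those of u and v. Choosing the sizes of the sections,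
-- then a preferential arrangement of the free one, gives p^k = a ⋆ k^•, i.e.
-- EGF(p^k) = A(m) e^{km} with A = EGF(a). The number σ_b(n) of surjections X_n → Fin b satisfies
-- σ_b ⋆ 1 = σ_{b+1} + σ_b (place the points one at a time), and summing over b telescopes to
-- a ⋆ 1 + δ = 2a, i.e. A(m) (2 − e^m) = 1. Hence p^k ⋆ 1 + k^• = 2 p^k, which is the theorem
-- coefficientwise after division by n!.
module Submission where

open import Defs
open import Data.Nat using (ℕ; suc; _≤_)
open import Data.Fin using (Fin)
open import Data.Rational using (ℚ; 1ℚ)
open import Relation.Binary.PropositionalEquality using (_≡_)

open import Algebra.Bundles using (CommutativeMonoid)
open import Data.Bool.Base using (Bool; true; false; not; _∧_; _∨_; if_then_else_)
open import Data.Bool.ListAction using (and; all)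
import Data.Bool.Properties as Bool
open import Data.Fin.Base using () renaming (zero to fzero; suc to fsuc)
open import Data.Fin.Properties using (_≟_)
import Data.Integer.Base as ℤ
open import Data.Integer.Properties using (pos-+; pos-*)
open import Data.Integer.Tactic.RingSolver using (solve-∀)
open import Data.List.Base using (List; []; _∷_; _++_; map; concat; concatMap; filter; length; applyUpTo; upTo; tabulate; allFin)
open import Data.List.Properties
  using (applyUpTo-∷ʳ; map-upTo; map-applyUpTo; map-cong-local; map-cong; map-∘; map-concatMap; map-tabulate; tabulate-cong)
open import Data.List.Relation.Unary.All using (All; []; _∷_)
import Data.List.Relation.Unary.All as All
open import Data.List.Relation.Unary.All.Properties using (map⁺; concat⁺; applyUpTo⁺₁)
open import Data.Nat using (zero; _+_; _*_; _∸_; _^_; _!; _<_; pred; z≤n; s≤s; s≤s⁻¹)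
import Data.Nat as ℕ
open import Data.Nat.Combinatorics using (_C_; nCk+nC[k+1]≡[n+1]C[k+1]; k>n⇒nCk≡0; nCk≡n!/k![n-k]!; k![n∸k]!∣n!)
open import Data.Nat.DivMod using (m/n*n≡m; m*n/n≡m)
open import Data.Nat.ListAction using (sum)
open import Data.Nat.ListAction.Properties using (sum-++)
open import Data.Nat.Properties
  using (+-identityʳ; +-assoc; +-comm; +-cancelʳ-≡; *-zeroʳ; *-identityˡ; *-identityʳ; *-comm; *-assoc; *-distribˡ-+; ^-zeroˡ;
         n<1+n; m<n⇒m<1+n; m≤m+n; +-∸-assoc; m+[n∸m]≡n; m+n∸n≡m; m*n≢0; _!≢0; _!*_!≢0)
open import Data.Nat.Solver using (module +-*-Solver)
open import Data.Rational.Base using (_/_; -_; toℚᵘ; 0ℚ) renaming (_+_ to _+ℚ_; _*_ to _*ℚ_; _-_ to _-ℚ_)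
open import Data.Rational.Properties using (toℚᵘ-injective; toℚᵘ-fromℚᵘ; fromℚᵘ-cong; toℚᵘ-homo-+; toℚᵘ-homo-*; 0/n≡0)
import Data.Rational.Properties as ℚ
open import Data.Rational.Unnormalised.Base using (mkℚᵘ; *≡*) renaming (_/_ to _/ᵘ_; _≃_ to _≃ᵘ_)
import Data.Rational.Unnormalised.Base as ℚᵘ
import Data.Rational.Unnormalised.Properties as ℚᵘ
open import Data.Vec.Base using (Vec; []; _∷_)
import Data.Vec.Base as Vec
open import Function using (_∘_)
open import Relation.Binary.PropositionalEquality using (refl; sym; trans; cong; cong₂; _≗_; module ≡-Reasoning)
open import Relation.Nullary.Decidable using (⌊_⌋; ⌊⌋-map′)

open import Algebra.Properties.AbelianGroup ℚ.+-0-abelianGroup using (xyx⁻¹≈y; ⁻¹-∙-comm)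
open import Algebra.Properties.CommutativeSemigroup
  (CommutativeMonoid.commutativeSemigroup ℚ.+-0-commutativeMonoid) using (interchange)
open +-*-Solver using (solve; _:+_; _:*_; _:=_; con)

private variable
  A : Set
  n : ℕ
  f g : ℕ → A

applyUpTo-cong : (∀ {i} → i < n → f i ≡ g i) → applyUpTo f n ≡ applyUpTo g n
applyUpTo-cong {n = zero}  eq = refl
applyUpTo-cong {n = suc n} eq = cong₂ _∷_ (eq (s≤s z≤n)) (applyUpTo-cong (eq ∘ s≤s))

sum-concat : (xss : List (List ℕ)) → sum (concat xss) ≡ sum (map sum xss)
sum-concat []         = refl
sum-concat (xs ∷ xss) = trans (sum-++ xs (concat xss)) (cong (sum xs +_) (sum-concat xss))

sum-map-concatMap : ∀ {B : Set} (h : B → ℕ) (g : A → List B) xs →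
                    sum (map h (concatMap g xs)) ≡ sum (map (λ x → sum (map h (g x))) xs)
sum-map-concatMap h g xs = begin
  sum (map h (concatMap g xs))              ≡⟨ cong sum (map-concatMap h g xs) ⟩
  sum (concat (map (map h ∘ g) xs))         ≡⟨ sum-concat (map (map h ∘ g) xs) ⟩
  sum (map sum (map (map h ∘ g) xs))        ≡⟨ cong sum (map-∘ xs) ⟨
  sum (map (λ x → sum (map h (g x))) xs)    ∎
  where open ≡-Reasoning

length-filter-true : (p : A → Bool) (xs : List A) →
                     length (filter (λ x → p x Bool.≟ true) xs) ≡ sum (map (λ x → if p x then 1 else 0) xs)
length-filter-true p []       = refl
length-filter-true p (x ∷ xs) with p x
... | true  = cong suc (length-filter-true p xs)
... | false = length-filter-true p xs

sum-map-scale : ∀ c (f : A → ℕ) xs → sum (map (λ x → c * f x) xs) ≡ c * sum (map f xs)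
sum-map-scale c f []       = sym (*-zeroʳ c)
sum-map-scale c f (x ∷ xs) = trans (cong (c * f x +_) (sum-map-scale c f xs)) (sym (*-distribˡ-+ c (f x) _))

∑< : ℕ → (ℕ → ℕ) → ℕ
∑< n f = sum (applyUpTo f n)

syntax ∑< n (λ i → x) = ∑[ i < n ] x

∑<-cong : ∀ n {f g : ℕ → ℕ} → (∀ {i} → i < n → f i ≡ g i) → ∑< n f ≡ ∑< n g
∑<-cong _ eq = cong sum (applyUpTo-cong eq)

∑<-distrib-+ : ∀ n (f g : ℕ → ℕ) → ∑[ i < n ] (f i + g i) ≡ ∑< n f + ∑< n g
∑<-distrib-+ zero    f g = refl
∑<-distrib-+ (suc n) f g = trans (cong (f 0 + g 0 +_) (∑<-distrib-+ n (f ∘ suc) (g ∘ suc)))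
  (solve 4 (λ a b c d → (a :+ b) :+ (c :+ d) := (a :+ c) :+ (b :+ d)) refl
     (f 0) (g 0) (∑< n (f ∘ suc)) (∑< n (g ∘ suc)))

∑<-distribˡ-* : ∀ n c (f : ℕ → ℕ) → ∑[ i < n ] (c * f i) ≡ c * ∑< n f
∑<-distribˡ-* zero    c f = sym (*-zeroʳ c)
∑<-distribˡ-* (suc n) c f =
  trans (cong (c * f 0 +_) (∑<-distribˡ-* n c (f ∘ suc))) (sym (*-distribˡ-+ c (f 0) _))

∑<-suc : ∀ n (f : ℕ → ℕ) → ∑< (suc n) f ≡ ∑< n f + f n
∑<-suc n f = begin
  sum (applyUpTo f (suc n))               ≡⟨ cong sum (applyUpTo-∷ʳ f n) ⟨
  sum (applyUpTo f n ++ f n ∷ [])         ≡⟨ sum-++ (applyUpTo f n) _ ⟩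
  ∑< n f + (f n + 0)                      ≡⟨ cong (∑< n f +_) (+-identityʳ (f n)) ⟩
  ∑< n f + f n                            ∎
  where open ≡-Reasoning

∑<-zero : ∀ n (f : ℕ → ℕ) → (∀ {i} → i < n → f i ≡ 0) → ∑< n f ≡ 0
∑<-zero zero    f eq = refl
∑<-zero (suc n) f eq = cong₂ _+_ (eq (s≤s z≤n)) (∑<-zero n (f ∘ suc) (eq ∘ s≤s))

∑<-comm : ∀ m n (f : ℕ → ℕ → ℕ) → ∑[ i < m ] ∑[ j < n ] f i j ≡ ∑[ j < n ] ∑[ i < m ] f i j
∑<-comm zero    n f = sym (∑<-zero n _ (λ _ → refl))
∑<-comm (suc m) n f =
  trans (cong (∑< n (f 0) +_) (∑<-comm m n (f ∘ suc))) (sym (∑<-distrib-+ n (f 0) _))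

∑<-+-vanishing : ∀ m n (f : ℕ → ℕ) → (∀ j → f (m + j) ≡ 0) → ∑< (m + n) f ≡ ∑< m f
∑<-+-vanishing zero    n f eq = ∑<-zero n f (λ {i} _ → eq i)
∑<-+-vanishing (suc m) n f eq = cong (f 0 +_) (∑<-+-vanishing m n (f ∘ suc) eq)

-- Binomial convolution

infixl 7 _⋆_

_⋆_ : (ℕ → ℕ) → (ℕ → ℕ) → ℕ → ℕ
(u ⋆ v) n = ∑[ i < suc n ] ((n C i) * u i * v (n ∸ i))

δ : ℕ → ℕ
δ zero    = 1
δ (suc _) = 0

⋆-congˡ-≤ : ∀ {u u′} v → (∀ {i} → i ≤ n → u i ≡ u′ i) → (u ⋆ v) n ≡ (u′ ⋆ v) n
⋆-congˡ-≤ {n} v eq = ∑<-cong (suc n) (λ {i} i<1+n → cong (λ x → (n C i) * x * v (n ∸ i)) (eq (s≤s⁻¹ i<1+n)))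

⋆-congˡ : ∀ {u u′} v → u ≗ u′ → u ⋆ v ≗ u′ ⋆ v
⋆-congˡ v eq n = ⋆-congˡ-≤ v (λ {i} _ → eq i)

⋆-congʳ : ∀ u {v v′} → v ≗ v′ → u ⋆ v ≗ u ⋆ v′
⋆-congʳ u eq n = ∑<-cong (suc n) (λ {i} _ → cong ((n C i) * u i *_) (eq (n ∸ i)))

⋆-distribʳ-+ : ∀ u u′ v → (λ i → u i + u′ i) ⋆ v ≗ λ n → (u ⋆ v) n + (u′ ⋆ v) n
⋆-distribʳ-+ u u′ v n = trans
  (∑<-cong (suc n) (λ {i} _ → solve 4 (λ c x y z → c :* (x :+ y) :* z := c :* x :* z :+ c :* y :* z) refl
                        (n C i) (u i) (u′ i) (v (n ∸ i))))
  (∑<-distrib-+ (suc n) (λ i → (n C i) * u i * v (n ∸ i)) (λ i → (n C i) * u′ i * v (n ∸ i)))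

⋆-distribˡ-+ : ∀ u v v′ → u ⋆ (λ i → v i + v′ i) ≗ λ n → (u ⋆ v) n + (u ⋆ v′) n
⋆-distribˡ-+ u v v′ n = trans
  (∑<-cong (suc n) (λ {i} _ → solve 4 (λ c x y z → c :* x :* (y :+ z) := c :* x :* y :+ c :* x :* z) refl
                        (n C i) (u i) (v (n ∸ i)) (v′ (n ∸ i))))
  (∑<-distrib-+ (suc n) (λ i → (n C i) * u i * v (n ∸ i)) (λ i → (n C i) * u i * v′ (n ∸ i)))

⋆-scaleˡ : ∀ c u v → (λ i → c * u i) ⋆ v ≗ λ n → c * (u ⋆ v) n
⋆-scaleˡ c u v n = trans
  (∑<-cong (suc n) (λ {i} _ → solve 4 (λ b c x z → b :* (c :* x) :* z := c :* (b :* x :* z)) refl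
                        (n C i) c (u i) (v (n ∸ i))))
  (∑<-distribˡ-* (suc n) c (λ i → (n C i) * u i * v (n ∸ i)))

⋆-scaleʳ : ∀ c u v → u ⋆ (λ i → c * v i) ≗ λ n → c * (u ⋆ v) n
⋆-scaleʳ c u v n = trans
  (∑<-cong (suc n) (λ {i} _ → solve 4 (λ b c x z → b :* x :* (c :* z) := c :* (b :* x :* z)) refl
                        (n C i) c (u i) (v (n ∸ i))))
  (∑<-distribˡ-* (suc n) c (λ i → (n C i) * u i * v (n ∸ i)))

⋆-distribʳ-∑ : ∀ m (f : ℕ → ℕ → ℕ) v → (λ i → ∑[ b < m ] f b i) ⋆ v ≗ λ n → ∑[ b < m ] (f b ⋆ v) n
⋆-distribʳ-∑ m f v n = begin
  ∑[ i < suc n ] ((n C i) * ∑[ b < m ] f b i * v (n ∸ i))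
    ≡⟨ ∑<-cong (suc n) (λ {i} _ → trans (cong (_* v (n ∸ i)) (sym (∑<-distribˡ-* m (n C i) (λ b → f b i))))
                                        (trans (*-comm _ (v (n ∸ i)))
                                               (sym (∑<-distribˡ-* m (v (n ∸ i)) (λ b → (n C i) * f b i))))) ⟩
  ∑[ i < suc n ] ∑[ b < m ] (v (n ∸ i) * ((n C i) * f b i))
    ≡⟨ ∑<-comm (suc n) m (λ i b → v (n ∸ i) * ((n C i) * f b i)) ⟩
  ∑[ b < m ] ∑[ i < suc n ] (v (n ∸ i) * ((n C i) * f b i))
    ≡⟨ ∑<-cong m (λ {b} _ → ∑<-cong (suc n) (λ {i} _ → *-comm (v (n ∸ i)) ((n C i) * f b i))) ⟩
  ∑[ b < m ] (f b ⋆ v) n ∎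
  where open ≡-Reasoning

⋆-identityˡ : ∀ v → δ ⋆ v ≗ v
⋆-identityˡ v n = begin
  1 * 1 * v n + ∑[ i < n ] ((n C suc i) * 0 * v (n ∸ suc i))
    ≡⟨ cong (1 * 1 * v n +_) (∑<-zero n _ (λ {i} _ → cong (_* v (n ∸ suc i)) (*-zeroʳ (n C suc i)))) ⟩
  1 * 1 * v n + 0
    ≡⟨ trans (+-identityʳ _) (*-identityˡ (v n)) ⟩
  v n ∎
  where open ≡-Reasoning

⋆-suc : ∀ u v n → (u ⋆ v) (suc n) ≡ (u ⋆ (v ∘ suc)) n + ((u ∘ suc) ⋆ v) n
⋆-suc u v n = begin
  (u ⋆ v) (suc n)
    ≡⟨ cong (u₀ +_) (∑<-cong (suc n) (λ {i} _ → pascal i)) ⟩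
  u₀ + ∑[ i < suc n ] ((n C i) * u (suc i) * v (n ∸ i) + (n C suc i) * u (suc i) * v (n ∸ i))
    ≡⟨ cong (u₀ +_) (∑<-distrib-+ (suc n) (λ i → (n C i) * u (suc i) * v (n ∸ i)) upper) ⟩
  u₀ + (((u ∘ suc) ⋆ v) n + ∑< (suc n) upper)
    ≡⟨ cong (λ t → u₀ + (((u ∘ suc) ⋆ v) n + t)) upper-sum ⟩
  u₀ + (((u ∘ suc) ⋆ v) n + ∑< n shifted)
    ≡⟨ solve 3 (λ a x y → a :+ (x :+ y) := (a :+ y) :+ x) refl u₀ (((u ∘ suc) ⋆ v) n) (∑< n shifted) ⟩
  (u ⋆ (v ∘ suc)) n + ((u ∘ suc) ⋆ v) n ∎
  where
  open ≡-Reasoning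
  u₀ : ℕ
  u₀ = 1 * u 0 * v (suc n)
  upper shifted : ℕ → ℕ
  upper i = (n C suc i) * u (suc i) * v (n ∸ i)
  shifted i = (n C suc i) * u (suc i) * v (suc (n ∸ suc i))
  pascal : ∀ i → (suc n C suc i) * u (suc i) * v (n ∸ i) ≡ (n C i) * u (suc i) * v (n ∸ i) + upper i
  pascal i = trans (cong (λ c → c * u (suc i) * v (n ∸ i)) (sym (nCk+nC[k+1]≡[n+1]C[k+1] n i)))
    (solve 4 (λ a b x y → (a :+ b) :* x :* y := a :* x :* y :+ b :* x :* y) refl (n C i) (n C suc i) (u (suc i)) (v (n ∸ i)))
  upper-sum : ∑< (suc n) upper ≡ ∑< n shifted
  upper-sum = begin
    ∑< (suc n) upper         ≡⟨ ∑<-suc n upper ⟩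
    ∑< n upper + upper n     ≡⟨ cong (λ c → ∑< n upper + c * u (suc n) * v (n ∸ n)) (k>n⇒nCk≡0 (n<1+n n)) ⟩
    ∑< n upper + 0           ≡⟨ +-identityʳ _ ⟩
    ∑< n upper               ≡⟨ ∑<-cong n (λ {i} i<n → cong (λ j → (n C suc i) * u (suc i) * v j) (+-∸-assoc 1 i<n)) ⟩
    ∑< n shifted             ∎

⋆-comm : ∀ u v → u ⋆ v ≗ v ⋆ u
⋆-comm u v zero    = cong (_+ 0) (solve 2 (λ x y → con 1 :* x :* y := con 1 :* y :* x) refl (u 0) (v 0))
⋆-comm u v (suc n) = begin
  (u ⋆ v) (suc n)                                 ≡⟨ ⋆-suc u v n ⟩
  (u ⋆ (v ∘ suc)) n + ((u ∘ suc) ⋆ v) n          ≡⟨ cong₂ _+_ (⋆-comm u (v ∘ suc) n) (⋆-comm (u ∘ suc) v n) ⟩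
  ((v ∘ suc) ⋆ u) n + (v ⋆ (u ∘ suc)) n          ≡⟨ +-comm ((v ∘ suc ⋆ u) n) _ ⟩
  (v ⋆ (u ∘ suc)) n + ((v ∘ suc) ⋆ u) n          ≡⟨ ⋆-suc v u n ⟨
  (v ⋆ u) (suc n)                                 ∎
  where open ≡-Reasoning

⋆-assoc : ∀ u v w → (u ⋆ v) ⋆ w ≗ u ⋆ (v ⋆ w)
⋆-assoc u v w zero    = cong (_+ 0) (solve 3 (λ x y z → con 1 :* (con 1 :* x :* y :+ con 0) :* z
                                                     := con 1 :* x :* (con 1 :* y :* z :+ con 0)) refl (u 0) (v 0) (w 0))
⋆-assoc u v w (suc n) = begin
  ((u ⋆ v) ⋆ w) (suc n)
    ≡⟨ ⋆-suc (u ⋆ v) w n ⟩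
  ((u ⋆ v) ⋆ (w ∘ suc)) n + ((u ⋆ v) ∘ suc ⋆ w) n
    ≡⟨ cong (((u ⋆ v) ⋆ (w ∘ suc)) n +_) (trans (⋆-congˡ w (⋆-suc u v) n)
                                               (⋆-distribʳ-+ (u ⋆ (v ∘ suc)) ((u ∘ suc) ⋆ v) w n)) ⟩
  ((u ⋆ v) ⋆ (w ∘ suc)) n + (((u ⋆ (v ∘ suc)) ⋆ w) n + (((u ∘ suc) ⋆ v) ⋆ w) n)
    ≡⟨ cong₂ _+_ (⋆-assoc u v (w ∘ suc) n) (cong₂ _+_ (⋆-assoc u (v ∘ suc) w n) (⋆-assoc (u ∘ suc) v w n)) ⟩
  (u ⋆ (v ⋆ (w ∘ suc))) n + ((u ⋆ ((v ∘ suc) ⋆ w)) n + ((u ∘ suc) ⋆ (v ⋆ w)) n)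
    ≡⟨ +-assoc ((u ⋆ (v ⋆ (w ∘ suc))) n) _ _ ⟨
  (u ⋆ (v ⋆ (w ∘ suc))) n + (u ⋆ ((v ∘ suc) ⋆ w)) n + ((u ∘ suc) ⋆ (v ⋆ w)) n
    ≡⟨ cong (_+ ((u ∘ suc) ⋆ (v ⋆ w)) n) (trans (⋆-congʳ u (⋆-suc v w) n)
                                                  (⋆-distribˡ-+ u (v ⋆ (w ∘ suc)) ((v ∘ suc) ⋆ w) n)) ⟨
  (u ⋆ ((v ⋆ w) ∘ suc)) n + ((u ∘ suc) ⋆ (v ⋆ w)) n
    ≡⟨ ⋆-suc u (v ⋆ w) n ⟨
  (u ⋆ (v ⋆ w)) (suc n) ∎
  where open ≡-Reasoning

1^⋆r^ : ∀ r → (1 ^_) ⋆ (r ^_) ≗ (suc r ^_)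
1^⋆r^ r zero    = refl
1^⋆r^ r (suc n) = begin
  ((1 ^_) ⋆ (r ^_)) (suc n)                                 ≡⟨ ⋆-suc (1 ^_) (r ^_) n ⟩
  ((1 ^_) ⋆ (λ i → r * r ^ i)) n + ((λ i → 1 * 1 ^ i) ⋆ (r ^_)) n
    ≡⟨ cong₂ _+_ (⋆-scaleʳ r (1 ^_) (r ^_) n) (⋆-scaleˡ 1 (1 ^_) (r ^_) n) ⟩
  r * ((1 ^_) ⋆ (r ^_)) n + 1 * ((1 ^_) ⋆ (r ^_)) n         ≡⟨ cong (λ t → r * t + 1 * t) (1^⋆r^ r n) ⟩
  r * suc r ^ n + 1 * suc r ^ n                             ≡⟨ solve 2 (λ r x → r :* x :+ con 1 :* x := (con 1 :+ r) :* x) refl r (suc r ^ n) ⟩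
  suc r ^ suc n                                             ∎
  where open ≡-Reasoning

-- Surjections and Fubini numbers

-- The number of maps from an n-set to r required and s free values hitting every required value:
-- the first point goes either to one of the r required values, which then becomes free, or to a
-- free value.
hitCount : ℕ → ℕ → ℕ → ℕ
hitCount zero    zero    s = 1
hitCount zero    (suc r) s = 0
hitCount (suc n) r       s = r * hitCount n (pred r) (suc s) + s * hitCount n r s

-- An extra free value is either hit, and may then be counted as required, or not hit at all.
hitCount-suc-free : ∀ n r s → hitCount n r (suc s) ≡ hitCount n (suc r) s + hitCount n r s
hitCount-suc-free zero    zero    s = refl
hitCount-suc-free zero    (suc r) s = refl
hitCount-suc-free (suc n) zero    s rewrite hitCount-suc-free n zero s =
  solve 3 (λ s x y → (con 1 :+ s) :* (x :+ y) := (con 1 :* (x :+ y) :+ s :* x) :+ s :* y) refl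
    s (hitCount n 1 s) (hitCount n 0 s)
hitCount-suc-free (suc n) (suc r) s rewrite hitCount-suc-free n r (suc s) | hitCount-suc-free n (suc r) s =
  solve 5 (λ r s x y z → (con 1 :+ r) :* ((x :+ y) :+ z) :+ (con 1 :+ s) :* (x :+ y)
                        := ((con 2 :+ r) :* (x :+ y) :+ s :* x) :+ ((con 1 :+ r) :* z :+ s :* y)) refl
    r s (hitCount n (suc (suc r)) s) (hitCount n (suc r) s) (hitCount n r (suc s))

hitCount-vanishing : ∀ {n r} s → n < r → hitCount n r s ≡ 0
hitCount-vanishing {zero}  {suc r} s _ = refl
hitCount-vanishing {suc n} {suc r} s (s≤s n<r)
  rewrite hitCount-vanishing (suc s) n<r | hitCount-vanishing {n} {suc r} s (m<n⇒m<1+n n<r) =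
  cong₂ _+_ (*-zeroʳ (suc r)) (*-zeroʳ s)

surj : ℕ → ℕ → ℕ
surj b n = hitCount n b 0

surj-suc : ∀ b n → surj b (suc n) ≡ b * (surj b n + surj (pred b) n)
surj-suc zero    n = refl
surj-suc (suc b) n = trans (+-identityʳ _) (cong (suc b *_) (hitCount-suc-free n b 0))

surj-zero : surj 0 ≗ δ
surj-zero zero    = refl
surj-zero (suc n) = refl

surj-⋆-1^ : ∀ b n → (surj b ⋆ (1 ^_)) n ≡ surj (suc b) n + surj b n
surj-⋆-1^ zero    zero = refl
surj-⋆-1^ (suc b) zero = refl
surj-⋆-1^ b (suc n) = begin
  (surj b ⋆ (1 ^_)) (suc n)
    ≡⟨ ⋆-suc (surj b) (1 ^_) n ⟩
  (surj b ⋆ (λ i → 1 * 1 ^ i)) n + ((surj b ∘ suc) ⋆ (1 ^_)) n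
    ≡⟨ cong₂ _+_ (⋆-congʳ (surj b) (λ i → *-identityˡ (1 ^ i)) n)
                 (trans (⋆-congˡ (1 ^_) (surj-suc b) n)
                 (trans (⋆-scaleˡ b (λ i → surj b i + surj (pred b) i) (1 ^_) n)
                        (cong (b *_) (⋆-distribʳ-+ (surj b) (surj (pred b)) (1 ^_) n)))) ⟩
  (surj b ⋆ (1 ^_)) n + b * ((surj b ⋆ (1 ^_)) n + (surj (pred b) ⋆ (1 ^_)) n)
    ≡⟨ cong₂ (λ x y → x + b * (x + y)) (surj-⋆-1^ b n) (surj-⋆-1^ (pred b) n) ⟩
  (surj (suc b) n + surj b n) + b * ((surj (suc b) n + surj b n) + (surj (suc (pred b)) n + surj (pred b) n))
    ≡⟨ regroup b ⟩
  suc b * (surj (suc b) n + surj b n) + b * (surj b n + surj (pred b) n)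
    ≡⟨ cong₂ _+_ (surj-suc (suc b) n) (surj-suc b n) ⟨
  surj (suc b) (suc n) + surj b (suc n) ∎
  where
  open ≡-Reasoning
  regroup : ∀ b → (surj (suc b) n + surj b n) + b * ((surj (suc b) n + surj b n) + (surj (suc (pred b)) n + surj (pred b) n))
                ≡ suc b * (surj (suc b) n + surj b n) + b * (surj b n + surj (pred b) n)
  regroup zero    = sym (+-identityʳ _)
  regroup (suc b) = solve 4 (λ b x y z → (x :+ y) :+ b :* ((x :+ y) :+ (y :+ z)) := (con 1 :+ b) :* (x :+ y) :+ b :* (y :+ z)) refl
                      (suc b) (surj (suc (suc b)) n) (surj (suc b) n) (surj b n)

fubini : ℕ → ℕ
fubini n = ∑[ b < suc n ] surj b n

fubini-∑< : ∀ {i n} → i ≤ n → fubini i ≡ ∑[ b < suc n ] surj b i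
fubini-∑< {i} {n} i≤n = begin
  ∑[ b < suc i ] surj b i               ≡⟨ ∑<-+-vanishing (suc i) (n ∸ i) (λ b → surj b i) (λ j → hitCount-vanishing 0 (s≤s (m≤m+n i j))) ⟨
  ∑[ b < suc i + (n ∸ i) ] surj b i     ≡⟨ cong (λ m → ∑[ b < suc m ] surj b i) (m+[n∸m]≡n i≤n) ⟩
  ∑[ b < suc n ] surj b i               ∎
  where open ≡-Reasoning

fubini-⋆-1^ : ∀ n → (fubini ⋆ (1 ^_)) n + δ n ≡ fubini n + fubini n
fubini-⋆-1^ n = begin
  (fubini ⋆ (1 ^_)) n + δ n
    ≡⟨ cong (_+ δ n) (⋆-congˡ-≤ {n = n} (1 ^_) fubini-∑<) ⟩
  ((λ i → ∑[ b < suc n ] surj b i) ⋆ (1 ^_)) n + δ n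
    ≡⟨ cong (_+ δ n) (⋆-distribʳ-∑ (suc n) surj (1 ^_) n) ⟩
  ∑[ b < suc n ] (surj b ⋆ (1 ^_)) n + δ n
    ≡⟨ cong (_+ δ n) (trans (∑<-cong (suc n) (λ {b} _ → surj-⋆-1^ b n))
                            (∑<-distrib-+ (suc n) (λ b → surj (suc b) n) (λ b → surj b n))) ⟩
  ∑[ b < suc n ] surj (suc b) n + fubini n + δ n
    ≡⟨ solve 3 (λ x y z → x :+ y :+ z := z :+ x :+ y) refl (∑[ b < suc n ] surj (suc b) n) (fubini n) (δ n) ⟩
  δ n + ∑[ b < suc n ] surj (suc b) n + fubini n
    ≡⟨ cong (λ d → d + ∑[ b < suc n ] surj (suc b) n + fubini n) (surj-zero n) ⟨
  ∑[ b < suc (suc n) ] surj b n + fubini n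
    ≡⟨ cong (_+ fubini n) (∑<-suc (suc n) (λ b → surj b n)) ⟩
  fubini n + surj (suc n) n + fubini n
    ≡⟨ cong (λ x → fubini n + x + fubini n) (hitCount-vanishing 0 (n<1+n n)) ⟩
  fubini n + 0 + fubini n
    ≡⟨ cong (_+ fubini n) (+-identityʳ (fubini n)) ⟩
  fubini n + fubini n ∎
  where open ≡-Reasoning

-- Enumerating maps X_n → Fin b

∑ᶠ : ∀ {b} → (Fin b → ℕ) → ℕ
∑ᶠ F = sum (tabulate F)

∑ᶠ-cong : ∀ {b} {F G : Fin b → ℕ} → F ≗ G → ∑ᶠ F ≡ ∑ᶠ G
∑ᶠ-cong eq = cong sum (tabulate-cong eq)

∑ᶠ-update : ∀ {b} (F : Fin b → ℕ) i y → ∑ᶠ (λ j → if ⌊ i ≟ j ⌋ then y else F j) + F i ≡ ∑ᶠ F + y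
∑ᶠ-update F fzero    y = solve 3 (λ a s y → (y :+ s) :+ a := (a :+ s) :+ y) refl (F fzero) (∑ᶠ (F ∘ fsuc)) y
∑ᶠ-update F (fsuc i) y = begin
  F fzero + ∑ᶠ (λ j → if ⌊ fsuc i ≟ fsuc j ⌋ then y else F (fsuc j)) + F (fsuc i)
    ≡⟨ cong (λ s → F fzero + s + F (fsuc i))
            (∑ᶠ-cong (λ j → cong (if_then y else F (fsuc j)) (⌊⌋-map′ _ _ (i ≟ j)))) ⟩
  F fzero + ∑ᶠ (λ j → if ⌊ i ≟ j ⌋ then y else F (fsuc j)) + F (fsuc i)
    ≡⟨ +-assoc (F fzero) _ _ ⟩
  F fzero + (∑ᶠ (λ j → if ⌊ i ≟ j ⌋ then y else F (fsuc j)) + F (fsuc i))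
    ≡⟨ cong (F fzero +_) (∑ᶠ-update (F ∘ fsuc) i y) ⟩
  F fzero + (∑ᶠ (F ∘ fsuc) + y)
    ≡⟨ +-assoc (F fzero) _ _ ⟨
  ∑ᶠ F + y ∎
  where open ≡-Reasoning

all-allFin-suc : ∀ {b} (p : Fin (suc b) → Bool) → all p (allFin (suc b)) ≡ p fzero ∧ all (p ∘ fsuc) (allFin b)
all-allFin-suc p = cong (λ bs → p fzero ∧ and bs) (trans (map-tabulate fsuc p) (sym (map-tabulate (λ j → j) (p ∘ fsuc))))

sum-map-allFin : ∀ {b} (F : Fin b → ℕ) → sum (map F (allFin b)) ≡ ∑ᶠ F
sum-map-allFin F = cong sum (map-tabulate (λ j → j) F)

tally : ∀ {b} → (Fin b → Bool) → ℕ → ℕ → ℕ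
tally R x y = ∑ᶠ (λ j → if R j then x else y)

tally-linear : ∀ {b} (R : Fin b → Bool) x y → tally R x y ≡ tally R 1 0 * x + tally R 0 1 * y
tally-linear {zero}  R x y = refl
tally-linear {suc b} R x y with R fzero
... | true  = trans (cong (x +_) (tally-linear (R ∘ fsuc) x y))
                (solve 4 (λ x y t f → x :+ (t :* x :+ f :* y) := (con 1 :+ t) :* x :+ f :* y) refl
                   x y (tally (R ∘ fsuc) 1 0) (tally (R ∘ fsuc) 0 1))
... | false = trans (cong (y +_) (tally-linear (R ∘ fsuc) x y))
                (solve 4 (λ x y t f → y :+ (t :* x :+ f :* y) := t :* x :+ (con 1 :+ f) :* y) refl
                   x y (tally (R ∘ fsuc) 1 0) (tally (R ∘ fsuc) 0 1))

tally-true : ∀ b x y → tally {b} (λ _ → true) x y ≡ b * x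
tally-true zero    x y = refl
tally-true (suc b) x y = cong (x +_) (tally-true b x y)

remove : ∀ {b} → (Fin b → Bool) → Fin b → Fin b → Bool
remove R i j = R j ∧ not ⌊ i ≟ j ⌋

tally-remove : ∀ {b} (R : Fin b → Bool) i x y → tally (remove R i) x y + (if R i then x else y) ≡ tally R x y + y
tally-remove R i x y = trans (cong (_+ _) (∑ᶠ-cong (λ j → if-remove (R j) ⌊ i ≟ j ⌋)))
                             (∑ᶠ-update (λ j → if R j then x else y) i y)
  where
  if-remove : ∀ r d → (if r ∧ not d then x else y) ≡ (if d then y else if r then x else y)
  if-remove true  true  = refl
  if-remove true  false = refl
  if-remove false true  = refl
  if-remove false false = refl

hitCount-remove : ∀ {b} n (R : Fin b → Bool) i →
                  hitCount n (tally (remove R i) 1 0) (tally (remove R i) 0 1)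
                  ≡ (if R i then hitCount n (pred (tally R 1 0)) (suc (tally R 0 1)) else hitCount n (tally R 1 0) (tally R 0 1))
hitCount-remove n R i with R i | tally-remove R i 1 0 | tally-remove R i 0 1
... | true  | eq₁ | eq₂ = cong₂ (hitCount n) (trans (sym (m+n∸n≡m _ 1)) (cong pred (trans eq₁ (+-identityʳ _))))
                                            (trans (sym (+-identityʳ _)) (trans eq₂ (+-comm _ 1)))
... | false | eq₁ | eq₂ = cong₂ (hitCount n) (trans (sym (+-identityʳ _)) (trans eq₁ (+-identityʳ _)))
                                            (+-cancelʳ-≡ 1 _ _ eq₂)

hits : ∀ {b n} → Vec (Fin b) n → Fin b → Bool
hits f j = Vec.foldr _ (λ i r → ⌊ i ≟ j ⌋ ∨ r) false f

-- isSurjective f is hitsAll (λ _ → true) f; letting R mark an arbitrary set of values that must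
-- be hit is what makes the induction on n go through.
hitsAll : ∀ {b n} → (Fin b → Bool) → Vec (Fin b) n → Bool
hitsAll {b} R f = all (λ j → not (R j) ∨ hits f j) (allFin b)

hitsAll-∷ : ∀ {b n} (R : Fin b → Bool) i (f : Vec (Fin b) n) → hitsAll R (i ∷ f) ≡ hitsAll (remove R i) f
hitsAll-∷ {b} R i f = cong and (map-cong (λ j → ∨-remove (R j) ⌊ i ≟ j ⌋ (hits f j)) (allFin b))
  where
  ∨-remove : ∀ r d h → not r ∨ (d ∨ h) ≡ not (r ∧ not d) ∨ h
  ∨-remove true  true  h = refl
  ∨-remove true  false h = refl
  ∨-remove false d     h = refl

#hitsAll : ∀ {b} → (Fin b → Bool) → ℕ → ℕ
#hitsAll {b} R n = sum (map (λ f → if hitsAll R f then 1 else 0) (allMaps b n))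

#hitsAll-zero : ∀ {b} (R : Fin b → Bool) s → #hitsAll R 0 ≡ hitCount 0 (tally R 1 0) s
#hitsAll-zero {zero}  R s = refl
#hitsAll-zero {suc b} R s with R fzero | all-allFin-suc (λ j → not (R j) ∨ false)
... | true  | eq = cong (λ h → (if h then 1 else 0) + 0) eq
... | false | eq = trans (cong (λ h → (if h then 1 else 0) + 0) eq) (#hitsAll-zero (R ∘ fsuc) s)

#hitsAll-suc : ∀ {b} (R : Fin b → Bool) n → #hitsAll R (suc n) ≡ ∑ᶠ (λ i → #hitsAll (remove R i) n)
#hitsAll-suc {b} R n = begin
  sum (map indicator (concatMap (λ i → map (i ∷_) (allMaps b n)) (allFin b)))
    ≡⟨ sum-map-concatMap indicator (λ i → map (i ∷_) (allMaps b n)) (allFin b) ⟩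
  sum (map (λ i → sum (map indicator (map (i ∷_) (allMaps b n)))) (allFin b))
    ≡⟨ cong sum (map-cong (λ i → cong sum (trans (sym (map-∘ (allMaps b n)))
                                                  (map-cong (λ f → cong (if_then 1 else 0) (hitsAll-∷ R i f)) (allMaps b n))))
                          (allFin b)) ⟩
  sum (map (λ i → #hitsAll (remove R i) n) (allFin b))
    ≡⟨ sum-map-allFin (λ i → #hitsAll (remove R i) n) ⟩
  ∑ᶠ (λ i → #hitsAll (remove R i) n) ∎
  where
  open ≡-Reasoning
  indicator : Vec (Fin b) (suc n) → ℕ
  indicator f = if hitsAll R f then 1 else 0

#hitsAll≡hitCount : ∀ n {b} (R : Fin b → Bool) → #hitsAll R n ≡ hitCount n (tally R 1 0) (tally R 0 1)
#hitsAll≡hitCount zero    R = #hitsAll-zero R (tally R 0 1)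
#hitsAll≡hitCount (suc n) R = begin
  #hitsAll R (suc n)
    ≡⟨ #hitsAll-suc R n ⟩
  ∑ᶠ (λ i → #hitsAll (remove R i) n)
    ≡⟨ ∑ᶠ-cong (λ i → trans (#hitsAll≡hitCount n (remove R i)) (hitCount-remove n R i)) ⟩
  tally R (hitCount n (pred t) (suc s)) (hitCount n t s)
    ≡⟨ tally-linear R _ _ ⟩
  hitCount (suc n) t s ∎
  where
  open ≡-Reasoning
  t s : ℕ
  t = tally R 1 0
  s = tally R 0 1

a≗fubini : a ≗ fubini
a≗fubini n = trans (cong sum (map-upTo _ (suc n))) (∑<-cong (suc n) (λ {b} _ → begin
  length (filter (λ f → isSurjective f Bool.≟ true) (allMaps b n))
    ≡⟨ length-filter-true (hitsAll (λ _ → true)) (allMaps b n) ⟩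
  #hitsAll (λ _ → true) n
    ≡⟨ #hitsAll≡hitCount n (λ _ → true) ⟩
  hitCount n (tally {b} (λ _ → true) 1 0) (tally {b} (λ _ → true) 0 1)
    ≡⟨ cong₂ (hitCount n) (trans (tally-true b 1 0) (*-identityʳ b)) (trans (tally-true b 0 1) (*-zeroʳ b)) ⟩
  surj b n ∎))
  where open ≡-Reasoning

a-⋆-1^ : ∀ n → (a ⋆ (1 ^_)) n + δ n ≡ a n + a n
a-⋆-1^ n = begin
  (a ⋆ (1 ^_)) n + δ n             ≡⟨ cong (_+ δ n) (⋆-congˡ (1 ^_) a≗fubini n) ⟩
  (fubini ⋆ (1 ^_)) n + δ n        ≡⟨ fubini-⋆-1^ n ⟩
  fubini n + fubini n              ≡⟨ cong₂ _+_ (a≗fubini n) (a≗fubini n) ⟨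
  a n + a n                        ∎
  where open ≡-Reasoning

-- Multinomial sums

nCk*k![n∸k]!≡n! : ∀ {n k} → k ≤ n → (n C k) * (k ! * (n ∸ k) !) ≡ n !
nCk*k![n∸k]!≡n! {n} {k} k≤n = trans (cong (_* (k ! * (n ∸ k) !)) (nCk≡n!/k![n-k]! k≤n)) (m/n*n≡m (k![n∸k]!∣n! k≤n))
  where
  instance
    k![n∸k]!≢0 : ℕ.NonZero (k ! * (n ∸ k) !)
    k![n∸k]!≢0 = k !* (n ∸ k) !≢0

-- The multinomial coefficient as a product of binomial coefficients, matching the recursion
-- of compositions; the two agree only on compositions of n.
iteratedC : ∀ {r} → ℕ → Vec ℕ r → ℕ
iteratedC n []       = 1
iteratedC n (w ∷ ws) = (n C w) * iteratedC (n ∸ w) ws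

iteratedC*prodFact : ∀ r n → All (λ ws → iteratedC n ws * prodFact ws ≡ n !) (compositions r n)
iteratedC*prodFact zero    zero    = refl ∷ []
iteratedC*prodFact zero    (suc n) = []
iteratedC*prodFact (suc r) n = concat⁺ (map⁺ (applyUpTo⁺₁ (λ w → w) (suc n) (λ {w} w<1+n →
  map⁺ (All.map (λ {ws} → cons w (s≤s⁻¹ w<1+n) {ws}) (iteratedC*prodFact r (n ∸ w))))))
  where
  cons : ∀ w → w ≤ n → ∀ {ws : Vec ℕ r} → iteratedC (n ∸ w) ws * prodFact ws ≡ (n ∸ w) ! →
         iteratedC n (w ∷ ws) * prodFact (w ∷ ws) ≡ n !
  cons w w≤n {ws} eq = begin
    (n C w) * iteratedC (n ∸ w) ws * (w ! * prodFact ws)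
      ≡⟨ solve 4 (λ c m f q → c :* m :* (f :* q) := c :* (f :* (m :* q))) refl (n C w) (iteratedC (n ∸ w) ws) (w !) (prodFact ws) ⟩
    (n C w) * (w ! * (iteratedC (n ∸ w) ws * prodFact ws))
      ≡⟨ cong (λ x → (n C w) * (w ! * x)) eq ⟩
    (n C w) * (w ! * (n ∸ w) !)
      ≡⟨ nCk*k![n∸k]!≡n! w≤n ⟩
    n ! ∎
    where open ≡-Reasoning

multinomial≡iteratedC : ∀ {r n} {ws : Vec ℕ r} → iteratedC n ws * prodFact ws ≡ n ! → multinomial n ws ≡ iteratedC n ws
multinomial≡iteratedC {n = n} {ws} eq =
  trans (cong (λ x → (x ℕ./ prodFact ws) {{prodFact≢0 ws}}) (sym eq)) (m*n/n≡m (iteratedC n ws) (prodFact ws) {{prodFact≢0 ws}})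

sum-compositions-suc : ∀ r n (h : Vec ℕ (suc r) → ℕ) →
  sum (map h (compositions (suc r) n)) ≡ ∑[ w < suc n ] sum (map (λ ws → h (w ∷ ws)) (compositions r (n ∸ w)))
sum-compositions-suc r n h = begin
  sum (map h (concatMap (λ w → map (w ∷_) (compositions r (n ∸ w))) (upTo (suc n))))
    ≡⟨ sum-map-concatMap h (λ w → map (w ∷_) (compositions r (n ∸ w))) (upTo (suc n)) ⟩
  sum (map (λ w → sum (map h (map (w ∷_) (compositions r (n ∸ w))))) (upTo (suc n)))
    ≡⟨ cong sum (map-upTo _ (suc n)) ⟩
  ∑[ w < suc n ] sum (map h (map (w ∷_) (compositions r (n ∸ w))))
    ≡⟨ ∑<-cong (suc n) (λ {w} _ → cong sum (sym (map-∘ {g = h} {f = w ∷_} (compositions r (n ∸ w))))) ⟩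
  ∑[ w < suc n ] sum (map (λ ws → h (w ∷ ws)) (compositions r (n ∸ w))) ∎
  where open ≡-Reasoning

nCk*1^k≡nCk : ∀ n w → (n C w) * 1 ^ w ≡ n C w
nCk*1^k≡nCk n w = trans (cong ((n C w) *_) (^-zeroˡ w)) (*-identityʳ (n C w))

sum-iteratedC : ∀ r n → sum (map (iteratedC n) (compositions r n)) ≡ r ^ n
sum-iteratedC zero    zero    = refl
sum-iteratedC zero    (suc n) = refl
sum-iteratedC (suc r) n = begin
  sum (map (iteratedC n) (compositions (suc r) n))
    ≡⟨ sum-compositions-suc r n (iteratedC n) ⟩
  ∑[ w < suc n ] sum (map (λ ws → (n C w) * iteratedC (n ∸ w) ws) (compositions r (n ∸ w)))
    ≡⟨ ∑<-cong (suc n) (λ {w} _ → begin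
         sum (map (λ ws → (n C w) * iteratedC (n ∸ w) ws) (compositions r (n ∸ w)))
           ≡⟨ sum-map-scale (n C w) (iteratedC (n ∸ w)) (compositions r (n ∸ w)) ⟩
         (n C w) * sum (map (iteratedC (n ∸ w)) (compositions r (n ∸ w)))
           ≡⟨ cong₂ _*_ (sym (nCk*1^k≡nCk n w)) (sum-iteratedC r (n ∸ w)) ⟩
         (n C w) * 1 ^ w * r ^ (n ∸ w) ∎) ⟩
  ((1 ^_) ⋆ (r ^_)) n
    ≡⟨ 1^⋆r^ r n ⟩
  suc r ^ n ∎
  where open ≡-Reasoning

sum-iteratedC-lookup : ∀ r (j : Fin (suc r)) (u : ℕ → ℕ) n →
  sum (map (λ ws → iteratedC n ws * u (Vec.lookup ws j)) (compositions (suc r) n)) ≡ (u ⋆ (r ^_)) n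
sum-iteratedC-lookup r fzero u n = begin
  sum (map (λ ws → iteratedC n ws * u (Vec.lookup ws fzero)) (compositions (suc r) n))
    ≡⟨ sum-compositions-suc r n _ ⟩
  ∑[ w < suc n ] sum (map (λ ws → (n C w) * iteratedC (n ∸ w) ws * u w) (compositions r (n ∸ w)))
    ≡⟨ ∑<-cong (suc n) (λ {w} _ → begin
         sum (map (λ ws → (n C w) * iteratedC (n ∸ w) ws * u w) (compositions r (n ∸ w)))
           ≡⟨ cong sum (map-cong (λ ws → solve 3 (λ c m x → c :* m :* x := c :* x :* m) refl (n C w) (iteratedC (n ∸ w) ws) (u w))
                                 (compositions r (n ∸ w))) ⟩
         sum (map (λ ws → (n C w) * u w * iteratedC (n ∸ w) ws) (compositions r (n ∸ w)))
           ≡⟨ sum-map-scale ((n C w) * u w) (iteratedC (n ∸ w)) (compositions r (n ∸ w)) ⟩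
         (n C w) * u w * sum (map (iteratedC (n ∸ w)) (compositions r (n ∸ w)))
           ≡⟨ cong ((n C w) * u w *_) (sum-iteratedC r (n ∸ w)) ⟩
         (n C w) * u w * r ^ (n ∸ w) ∎) ⟩
  (u ⋆ (r ^_)) n ∎
  where open ≡-Reasoning
sum-iteratedC-lookup (suc r) (fsuc j) u n = begin
  sum (map (λ ws → iteratedC n ws * u (Vec.lookup ws (fsuc j))) (compositions (suc (suc r)) n))
    ≡⟨ sum-compositions-suc (suc r) n _ ⟩
  ∑[ w < suc n ] sum (map (λ ws → (n C w) * iteratedC (n ∸ w) ws * u (Vec.lookup ws j)) (compositions (suc r) (n ∸ w)))
    ≡⟨ ∑<-cong (suc n) (λ {w} _ → begin
         sum (map (λ ws → (n C w) * iteratedC (n ∸ w) ws * u (Vec.lookup ws j)) (compositions (suc r) (n ∸ w)))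
           ≡⟨ cong sum (map-cong (λ ws → *-assoc (n C w) _ _) (compositions (suc r) (n ∸ w))) ⟩
         sum (map (λ ws → (n C w) * (iteratedC (n ∸ w) ws * u (Vec.lookup ws j))) (compositions (suc r) (n ∸ w)))
           ≡⟨ sum-map-scale (n C w) _ (compositions (suc r) (n ∸ w)) ⟩
         (n C w) * sum (map (λ ws → iteratedC (n ∸ w) ws * u (Vec.lookup ws j)) (compositions (suc r) (n ∸ w)))
           ≡⟨ cong₂ _*_ (sym (nCk*1^k≡nCk n w)) (sum-iteratedC-lookup r j u (n ∸ w)) ⟩
         (n C w) * 1 ^ w * (u ⋆ (r ^_)) (n ∸ w) ∎) ⟩
  ((1 ^_) ⋆ (u ⋆ (r ^_))) n        ≡⟨ ⋆-comm (1 ^_) (u ⋆ (r ^_)) n ⟩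
  ((u ⋆ (r ^_)) ⋆ (1 ^_)) n        ≡⟨ ⋆-assoc u (r ^_) (1 ^_) n ⟩
  (u ⋆ ((r ^_) ⋆ (1 ^_))) n        ≡⟨ ⋆-congʳ u (λ i → trans (⋆-comm (r ^_) (1 ^_) i) (1^⋆r^ r i)) n ⟩
  (u ⋆ (suc r ^_)) n ∎
  where open ≡-Reasoning

p≗a⋆k^ : ∀ k j → p k j ≗ a ⋆ (k ^_)
p≗a⋆k^ k j n = trans
  (cong sum (map-cong-local (All.map (λ {ws} eq → cong (_* a (Vec.lookup ws j)) (multinomial≡iteratedC {n = n} {ws} eq))
                                     (iteratedC*prodFact (suc k) n))))
  (sum-iteratedC-lookup k j a n)

p-⋆-1^ : ∀ k j n → (p k j ⋆ (1 ^_)) n + k ^ n ≡ p k j n + p k j n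
p-⋆-1^ k j n = begin
  (p k j ⋆ (1 ^_)) n + k ^ n
    ≡⟨ cong₂ _+_ (⋆-congˡ (1 ^_) (p≗a⋆k^ k j) n) (sym (⋆-identityˡ (k ^_) n)) ⟩
  ((a ⋆ (k ^_)) ⋆ (1 ^_)) n + (δ ⋆ (k ^_)) n
    ≡⟨ cong (_+ (δ ⋆ (k ^_)) n) (begin
         ((a ⋆ (k ^_)) ⋆ (1 ^_)) n   ≡⟨ ⋆-assoc a (k ^_) (1 ^_) n ⟩
         (a ⋆ ((k ^_) ⋆ (1 ^_))) n   ≡⟨ ⋆-congʳ a (⋆-comm (k ^_) (1 ^_)) n ⟩
         (a ⋆ ((1 ^_) ⋆ (k ^_))) n   ≡⟨ ⋆-assoc a (1 ^_) (k ^_) n ⟨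
         ((a ⋆ (1 ^_)) ⋆ (k ^_)) n   ∎) ⟩
  ((a ⋆ (1 ^_)) ⋆ (k ^_)) n + (δ ⋆ (k ^_)) n
    ≡⟨ ⋆-distribʳ-+ (a ⋆ (1 ^_)) δ (k ^_) n ⟨
  ((λ i → (a ⋆ (1 ^_)) i + δ i) ⋆ (k ^_)) n
    ≡⟨ ⋆-congˡ (k ^_) a-⋆-1^ n ⟩
  ((λ i → a i + a i) ⋆ (k ^_)) n
    ≡⟨ ⋆-distribʳ-+ a a (k ^_) n ⟩
  (a ⋆ (k ^_)) n + (a ⋆ (k ^_)) n
    ≡⟨ cong₂ _+_ (p≗a⋆k^ k j n) (p≗a⋆k^ k j n) ⟨
  p k j n + p k j n ∎
  where open ≡-Reasoning

-- Fractions and exponential generating functions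

-- i / m in ℚ divides by a gcd; identities between fractions are proved in ℚᵘ, where i / m is
-- just mkℚᵘ i (m ∸ 1).
toℚᵘ-/ : ∀ i m .{{_ : ℕ.NonZero m}} → toℚᵘ (i / m) ≃ᵘ i /ᵘ m
toℚᵘ-/ i (suc m) = toℚᵘ-fromℚᵘ (mkℚᵘ i m)

/-cross : ∀ x y m n .{{_ : ℕ.NonZero m}} .{{_ : ℕ.NonZero n}} → x * n ≡ y * m → ℤ.+ x / m ≡ ℤ.+ y / n
/-cross x y (suc m) (suc n) eq = fromℚᵘ-cong {mkℚᵘ (ℤ.+ x) m} {mkℚᵘ (ℤ.+ y) n}
  (*≡* (trans (sym (pos-* x (suc n))) (trans (cong ℤ.+_ eq) (pos-* y (suc m)))))

/-* : ∀ x y m n .{{_ : ℕ.NonZero m}} .{{_ : ℕ.NonZero n}} →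
      (ℤ.+ x / m) *ℚ (ℤ.+ y / n) ≡ (ℤ.+ (x * y) / (m * n)) {{m*n≢0 m n}}
/-* x y m@(suc _) n@(suc _) = toℚᵘ-injective (begin
  toℚᵘ ((ℤ.+ x / m) *ℚ (ℤ.+ y / n))           ≈⟨ toℚᵘ-homo-* (ℤ.+ x / m) (ℤ.+ y / n) ⟩
  toℚᵘ (ℤ.+ x / m) ℚᵘ.* toℚᵘ (ℤ.+ y / n)      ≈⟨ ℚᵘ.*-cong (toℚᵘ-/ (ℤ.+ x) m) (toℚᵘ-/ (ℤ.+ y) n) ⟩
  ((ℤ.+ x) ℤ.* (ℤ.+ y)) /ᵘ (m * n)            ≈⟨ ℚᵘ.≃-reflexive (cong (_/ᵘ (m * n)) (sym (pos-* x y))) ⟩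
  ℤ.+ (x * y) /ᵘ (m * n)                      ≈⟨ toℚᵘ-/ (ℤ.+ (x * y)) (m * n) ⟨
  toℚᵘ (ℤ.+ (x * y) / (m * n))                ∎)
  where open ℚᵘ.≃-Reasoning

/-+ : ∀ x y m .{{_ : ℕ.NonZero m}} → ℤ.+ (x + y) / m ≡ (ℤ.+ x / m) +ℚ (ℤ.+ y / m)
/-+ x y m@(suc _) = toℚᵘ-injective (begin
  toℚᵘ (ℤ.+ (x + y) / m)                      ≈⟨ toℚᵘ-/ (ℤ.+ (x + y)) m ⟩
  ℤ.+ (x + y) /ᵘ m                            ≈⟨ *≡* common-denominator ⟩
  (ℤ.+ x /ᵘ m) ℚᵘ.+ (ℤ.+ y /ᵘ m)              ≈⟨ ℚᵘ.+-cong (toℚᵘ-/ (ℤ.+ x) m) (toℚᵘ-/ (ℤ.+ y) m) ⟨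
  toℚᵘ (ℤ.+ x / m) ℚᵘ.+ toℚᵘ (ℤ.+ y / m)      ≈⟨ toℚᵘ-homo-+ (ℤ.+ x / m) (ℤ.+ y / m) ⟨
  toℚᵘ ((ℤ.+ x / m) +ℚ (ℤ.+ y / m))           ∎)
  where
  open ℚᵘ.≃-Reasoning
  factor : ∀ i j k → (i ℤ.+ j) ℤ.* (k ℤ.* k) ≡ (i ℤ.* k ℤ.+ j ℤ.* k) ℤ.* k
  factor = solve-∀
  common-denominator : ℤ.+ (x + y) ℤ.* ℤ.+ (m * m) ≡ (ℤ.+ x ℤ.* ℤ.+ m ℤ.+ ℤ.+ y ℤ.* ℤ.+ m) ℤ.* ℤ.+ m
  common-denominator = trans (cong₂ ℤ._*_ (pos-+ x y) (pos-* m m)) (factor (ℤ.+ x) (ℤ.+ y) (ℤ.+ m))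

sumℚ-/ : ∀ m .{{_ : ℕ.NonZero m}} xs → sumℚ (map (λ x → ℤ.+ x / m) xs) ≡ ℤ.+ sum xs / m
sumℚ-/ m []       = sym (0/n≡0 m)
sumℚ-/ m (x ∷ xs) = trans (cong ((ℤ.+ x / m) +ℚ_) (sumℚ-/ m xs)) (sym (/-+ x (sum xs) m))

sumℚ-difference : ∀ (f g : A → ℚ) xs → sumℚ (map (λ x → f x -ℚ g x) xs) ≡ sumℚ (map f xs) -ℚ sumℚ (map g xs)
sumℚ-difference f g []       = refl
sumℚ-difference f g (x ∷ xs) = begin
  (f x -ℚ g x) +ℚ sumℚ (map (λ x → f x -ℚ g x) xs)     ≡⟨ cong ((f x -ℚ g x) +ℚ_) (sumℚ-difference f g xs) ⟩
  (f x -ℚ g x) +ℚ (S -ℚ T)                             ≡⟨ interchange (f x) (- g x) S (- T) ⟩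
  (f x +ℚ S) +ℚ (- g x +ℚ - T)                          ≡⟨ cong ((f x +ℚ S) +ℚ_) (⁻¹-∙-comm (g x) T) ⟩
  (f x +ℚ S) -ℚ (g x +ℚ T)                              ∎
  where
  open ≡-Reasoning
  S T : ℚ
  S = sumℚ (map f xs)
  T = sumℚ (map g xs)

⊛-applyUpTo : ∀ f g n → (f ⊛ g) n ≡ sumℚ (applyUpTo (λ i → f i *ℚ g (n ∸ i)) (suc n))
⊛-applyUpTo f g n = cong sumℚ (map-upTo (λ i → f i *ℚ g (n ∸ i)) (suc n))

⊛-distribˡ-⊖ : ∀ f g h n → (f ⊛ (g ⊖ h)) n ≡ (f ⊛ g) n -ℚ (f ⊛ h) n
⊛-distribˡ-⊖ f g h n = trans
  (cong sumℚ (map-cong (λ i → trans (ℚ.*-distribˡ-+ (f i) (g (n ∸ i)) (- h (n ∸ i)))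
                                    (cong (f i *ℚ g (n ∸ i) +ℚ_) (sym (ℚ.neg-distribʳ-* (f i) (h (n ∸ i))))))
                       (upTo (suc n))))
  (sumℚ-difference (λ i → f i *ℚ g (n ∸ i)) (λ i → f i *ℚ h (n ∸ i)) (upTo (suc n)))

⊛-constS : ∀ f c n → (f ⊛ constS c) n ≡ f n *ℚ c
⊛-constS f c zero    = ℚ.+-identityʳ (f 0 *ℚ c)
⊛-constS f c (suc n) = begin
  (f ⊛ constS c) (suc n)
    ≡⟨ ⊛-applyUpTo f (constS c) (suc n) ⟩
  f 0 *ℚ 0ℚ +ℚ sumℚ (applyUpTo (λ i → f (suc i) *ℚ constS c (n ∸ i)) (suc n))
    ≡⟨ cong₂ _+ℚ_ (ℚ.*-zeroʳ (f 0)) (sym (⊛-applyUpTo (f ∘ suc) (constS c) n)) ⟩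
  0ℚ +ℚ ((f ∘ suc) ⊛ constS c) n
    ≡⟨ ℚ.+-identityˡ _ ⟩
  ((f ∘ suc) ⊛ constS c) n
    ≡⟨ ⊛-constS (f ∘ suc) c n ⟩
  f (suc n) *ℚ c ∎
  where open ≡-Reasoning

egf-⋆ : ∀ u v n → (egf u ⊛ egf v) n ≡ egf (u ⋆ v) n
egf-⋆ u v n = begin
  (egf u ⊛ egf v) n
    ≡⟨ ⊛-applyUpTo (egf u) (egf v) n ⟩
  sumℚ (applyUpTo (λ i → egf u i *ℚ egf v (n ∸ i)) (suc n))
    ≡⟨ cong sumℚ (applyUpTo-cong (λ {i} i<1+n → term i (s≤s⁻¹ i<1+n))) ⟩
  sumℚ (applyUpTo (λ i → ℤ.+ summand i / n !) (suc n))
    ≡⟨ cong sumℚ (map-applyUpTo summand (λ x → ℤ.+ x / n !) (suc n)) ⟨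
  sumℚ (map (λ x → ℤ.+ x / n !) (applyUpTo summand (suc n)))
    ≡⟨ sumℚ-/ (n !) (applyUpTo summand (suc n)) ⟩
  egf (u ⋆ v) n ∎
  where
  open ≡-Reasoning
  instance
    n!≢0 : ℕ.NonZero (n !)
    n!≢0 = n !≢0
  summand : ℕ → ℕ
  summand i = (n C i) * u i * v (n ∸ i)
  term : ∀ i → i ≤ n → egf u i *ℚ egf v (n ∸ i) ≡ ℤ.+ summand i / n !
  term i i≤n = trans (/-* (u i) (v (n ∸ i)) (i !) ((n ∸ i) !) {{i !≢0}} {{(n ∸ i) !≢0}})
                     (/-cross (u i * v (n ∸ i)) (summand i) (i ! * (n ∸ i) !) (n !) {{i !* (n ∸ i) !≢0}} factorials)
    where
    factorials : u i * v (n ∸ i) * n ! ≡ summand i * (i ! * (n ∸ i) !)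
    factorials = trans (cong (u i * v (n ∸ i) *_) (sym (nCk*k![n∸k]!≡n! i≤n)))
      (solve 4 (λ x y c f → x :* y :* (c :* f) := c :* x :* y :* f) refl (u i) (v (n ∸ i)) (n C i) (i ! * (n ∸ i) !))

mainTheorem1 : (k : ℕ) → 1 ≤ k → (j₀ : Fin (suc k)) → (n : ℕ) →
    (egf (p k j₀) ⊛ (constS (Data.Rational._+_ 1ℚ 1ℚ) ⊖ expS 1)) n ≡ expS k n
mainTheorem1 k _ j₀ n = begin
  (egf P ⊛ (constS (1ℚ +ℚ 1ℚ) ⊖ expS 1)) n
    ≡⟨ ⊛-distribˡ-⊖ (egf P) (constS (1ℚ +ℚ 1ℚ)) (expS 1) n ⟩
  (egf P ⊛ constS (1ℚ +ℚ 1ℚ)) n -ℚ (egf P ⊛ egf (1 ^_)) n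
    ≡⟨ cong₂ _-ℚ_ (⊛-constS (egf P) (1ℚ +ℚ 1ℚ) n) (egf-⋆ P (1 ^_) n) ⟩
  egf P n *ℚ (1ℚ +ℚ 1ℚ) -ℚ egf Q n
    ≡⟨ cong (_-ℚ egf Q n) (trans (ℚ.*-distribˡ-+ (egf P n) 1ℚ 1ℚ) (cong₂ _+ℚ_ (ℚ.*-identityʳ (egf P n)) (ℚ.*-identityʳ (egf P n)))) ⟩
  (egf P n +ℚ egf P n) -ℚ egf Q n
    ≡⟨ cong (_-ℚ egf Q n) (/-+ (P n) (P n) (n !)) ⟨
  ℤ.+ (P n + P n) / n ! -ℚ egf Q n
    ≡⟨ cong (λ m → ℤ.+ m / n ! -ℚ egf Q n) (p-⋆-1^ k j₀ n) ⟨
  ℤ.+ (Q n + k ^ n) / n ! -ℚ egf Q n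
    ≡⟨ cong (_-ℚ egf Q n) (/-+ (Q n) (k ^ n) (n !)) ⟩
  (egf Q n +ℚ expS k n) -ℚ egf Q n
    ≡⟨ xyx⁻¹≈y (egf Q n) (expS k n) ⟩
  expS k n ∎
  where
  open ≡-Reasoning
  instance
    n!≢0 : ℕ.NonZero (n !)
    n!≢0 = n !≢0
  P Q : ℕ → ℕ
  P = p k j₀
  Q = P ⋆ (1 ^_)
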